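{- Let $M$ be a monotone triangle with $n$ rows. Then the sum of $\mathrm{W}(A)$ over all arrowed monotone triangles $A$ whose underlying monotone triangle (ignoring decorations) is $M$ equals $\mathrm{W}_0(M)\prod_{i=1}^n(uX_i+vX_i^{ -1}+w)$.
   Context: A monotone triangle $M=(m_{i,j})_{1\le j\le i\le n}$ has integer entries with $m_{i+1,j}\le m_{i,j}\le m_{i+1,j+1}$, $m_{i,j}<m_{i,j+1}$. An arrowed monotone triangle is a monotone triangle whose entries each carry one of $\nearrow,\nwarrow,\nwarrow\!\nearrow$, such that an entry equal to its northwest-neighbour $m_{i-1,j-1}$ carries $\nearrow$ and an entry equal to its northeast-neighbour $m_{i-1,j}$ carries $\nwarrow$; its weight is $\mathrm{W}(A)=u^{\#\nearrow}v^{\#\nwarrow}w^{\#\nwarrow\nearrow}\prod_{i=1}^nX_i^{(\text{sum of row } i)-(\text{sum of row } i-1)+(\#\nearrow\text{ in row } i)-(\#\nwarrow\text{ in row } i)}$ (row $0$ sum is $0$; counts are of entries with exactly that decoration). For $i<n$, $m_{i,j}$ is special if $m_{i+1,j}<m_{i,j}<m_{i+1,j+1}$, left-leaning if $m_{i,j}=m_{i+1,j}$, right-leaning if $m_{i,j}=m_{i+1,j+1}$; $s_i,l_i,r_i$ count these in row $i$ ($1\le i\le n-1$), $s_0=l_0=r_0=0$, $l=\sum l_i$, $r=\sum r_i$, $d_i(M)=\sum_{j}m_{i,j}-\sum_jm_{i-1,j}+r_{i-1}-l_{i-1}$, and $\mathrm{W}_0(M)=u^{r(M)}v^{l(M)}\prod_{i=1}^nX_i^{d_i(M)}(w+uX_i+vX_i^{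 -1})^{s_{i-1}(M)}$. -}

module Defs where

open import Level using (Level)
open import Data.Nat as ℕ using (ℕ; zero; suc)
open import Data.Integer as ℤ using (ℤ; +_; -[1+_])
open import Data.Bool using (Bool; true; false; _∧_; if_then_else_)
open import Data.Unit using (⊤)
open import Data.Product using (_×_; _,_)
open import Data.Maybe using (Maybe; just; nothing)
open import Data.Vec using (Vec; []; _∷_)
open import Data.List as L using (List)
open import Relation.Nullary using (does)
open import Algebra.Bundles using (CommutativeRing)

-- Triangular arrays: a Tri A n is the list of rows 1..n, row i having
-- i entries; the LAST row added (via _▷_) is the bottom row n.
infixl 5 _▷_
data Tri (A : Set) : ℕ → Set where
  []  : Tri A 0
  _▷_ : ∀ {n} → Tri A n → Vec A (suc n) → Tri A (suc n)

lastRow : ∀ {A n} → Tri A n → Vec A n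
lastRow []      = []
lastRow (t ▷ r) = r

Increasing : ∀ {k} → Vec ℤ k → Set
Increasing []           = ⊤
Increasing (a ∷ [])     = ⊤
Increasing (a ∷ b ∷ xs) = a ℤ.< b × Increasing (b ∷ xs)

Interlace : ∀ {k} → Vec ℤ k → Vec ℤ (suc k) → Set
Interlace []       (b ∷ [])      = ⊤
Interlace (a ∷ as) (b ∷ b' ∷ bs) = b ℤ.≤ a × a ℤ.≤ b' × Interlace as (b' ∷ bs)

IsMonotone : ∀ {n} → Tri ℤ n → Set
IsMonotone []      = ⊤
IsMonotone (t ▷ r) = IsMonotone t × Increasing r × Interlace (lastRow t) r

-- counts of special / left-leaning / right-leaning entries of the row
-- above a, relative to the row below b
sCount : ∀ {k} → Vec ℤ k → Vec ℤ (suc k) → ℕ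
sCount []       (b ∷ [])      = 0
sCount (a ∷ as) (b ∷ b' ∷ bs) =
  (if does (b ℤ.<? a) ∧ does (a ℤ.<? b') then 1 else 0) ℕ.+ sCount as (b' ∷ bs)

lCount : ∀ {k} → Vec ℤ k → Vec ℤ (suc k) → ℕ
lCount []       (b ∷ [])      = 0
lCount (a ∷ as) (b ∷ b' ∷ bs) =
  (if does (a ℤ.≟ b) then 1 else 0) ℕ.+ lCount as (b' ∷ bs)

rCount : ∀ {k} → Vec ℤ k → Vec ℤ (suc k) → ℕ
rCount []       (b ∷ [])      = 0
rCount (a ∷ as) (b ∷ b' ∷ bs) =
  (if does (a ℤ.≟ b') then 1 else 0) ℕ.+ rCount as (b' ∷ bs)

rowSum : ∀ {k} → Vec ℤ k → ℤ
rowSum []       = + 0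
rowSum (a ∷ as) = a ℤ.+ rowSum as

-- decorations: NE = ↗, NW = ↖, NWNE = ↖↗
data Arrow : Set where
  NE NW NWNE : Arrow

isNE isNW isNWNE : Arrow → ℕ
isNE NE = 1
isNE _  = 0
isNW NW = 1
isNW _  = 0
isNWNE NWNE = 1
isNWNE _    = 0

count : ∀ {k} → (Arrow → ℕ) → Vec Arrow k → ℕ
count f []       = 0
count f (d ∷ ds) = f d ℕ.+ count f ds

eqMaybe : Maybe ℤ → ℤ → Bool
eqMaybe nothing  b = false
eqMaybe (just a) b = does (a ℤ.≟ b)

isNEᵇ isNWᵇ : Arrow → Bool
isNEᵇ NE = true
isNEᵇ _  = false
isNWᵇ NW = true
isNWᵇ _  = false

implies : Bool → Bool → Bool
implies false _ = true
implies true  c = c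

cond : Maybe ℤ → Maybe ℤ → ℤ → Arrow → Bool
cond p q b d = implies (eqMaybe p b) (isNEᵇ d) ∧ implies (eqMaybe q b) (isNWᵇ d)

-- validity of the decoration d of row b, given the row above (p = the
-- northwest neighbour of the first remaining entry)
validRow' : ∀ {k} → Maybe ℤ → Vec ℤ k → Vec ℤ (suc k) → Vec Arrow (suc k) → Bool
validRow' p []       (b ∷ [])     (d ∷ [])     = cond p nothing b d
validRow' p (a ∷ as) (b ∷ b' ∷ bs) (d ∷ d' ∷ ds) =
  cond p (just a) b d ∧ validRow' (just a) as (b' ∷ bs) (d' ∷ ds)

validRow : ∀ {k} → Vec ℤ k → Vec ℤ (suc k) → Vec Arrow (suc k) → Bool
validRow = validRow' nothing

validDec : ∀ {n} → Tri ℤ n → Tri Arrow n → Bool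
validDec []      []        = true
validDec (t ▷ b) (dt ▷ d) = validDec t dt ∧ validRow (lastRow t) b d

allVec : ∀ k → List (Vec Arrow k)
allVec zero    = L.[ [] ]
allVec (suc k) = L.concatMap (λ d → L.map (d ∷_) (allVec k)) (NE L.∷ NW L.∷ NWNE L.∷ L.[])

allDec : ∀ n → List (Tri Arrow n)
allDec zero    = L.[ [] ]
allDec (suc n) = L.concatMap (λ t → L.map (t ▷_) (allVec (suc n))) (allDec n)

-- Weights, in an arbitrary commutative ring; X i (i = 1..n) are
-- variables with Xinv i their inverses.
module Weights {c ℓ : Level} (R : CommutativeRing c ℓ)
  (u v w : CommutativeRing.Carrier R)
  (X Xinv : ℕ → CommutativeRing.Carrier R) where
  open CommutativeRing R

  pow : Carrier → ℕ → Carrier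
  pow x zero    = 1#
  pow x (suc k) = x * pow x k

  zpow : ℕ → ℤ → Carrier
  zpow i (+ k)      = pow (X i) k
  zpow i -[1+ k ]   = pow (Xinv i) (suc k)

  sumR : List Carrier → Carrier
  sumR = L.foldr _+_ 0#

  W : ∀ {n} → Tri ℤ n → Tri Arrow n → Carrier
  W []                 []        = 1#
  W {suc k} (t ▷ b) (dt ▷ d) =
    W t dt * (pow u (count isNE d) * pow v (count isNW d) * pow w (count isNWNE d)
      * zpow (suc k) (rowSum b ℤ.- rowSum (lastRow t)
                       ℤ.+ + count isNE d ℤ.- + count isNW d))

  W₀ : ∀ {n} → Tri ℤ n → Carrier
  W₀ []            = 1#
  W₀ {suc k} (t ▷ b) =
    W₀ t * (pow u (rCount a b) * pow v (lCount a b)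
      * zpow (suc k) (rowSum b ℤ.- rowSum a ℤ.+ + rCount a b ℤ.- + lCount a b)
      * pow (w + u * X (suc k) + v * Xinv (suc k)) (sCount a b))
    where a = lastRow t

  lhs : ∀ {n} → Tri ℤ n → Carrier
  lhs {n} M = sumR (L.map (λ D → if validDec M D then W M D else 0#) (allDec n))

  prodFactor : ℕ → Carrier
  prodFactor zero    = 1#
  prodFactor (suc i) = prodFactor i * (u * X (suc i) + v * Xinv (suc i) + w)

  rhs : ∀ {n} → Tri ℤ n → Carrier
  rhs {n} M = W₀ M * prodFactor n

-- The decorations of different rows are independent, so the sum over arrowed
-- triangles factorises into one sum per row.  Within row i the weight of a
-- decoration is X_i^(row-sum difference) times a product of arrow weights
-- uX_i, vX_i⁻¹, w, and the arrow constraints act entry by entry: an entry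
-- equal to its northwest (northeast) neighbour contributes uX_i (vX_i⁻¹) --
-- never both, as rows increase strictly -- and any other entry contributes
-- t_i = uX_i + vX_i⁻¹ + w.  Pairing the entries of row i with those of row i-1
-- turns this into one factor per entry of row i-1: uX_i if it is
-- right-leaning, vX_i⁻¹ if left-leaning, t_i if special, times one extra t_i.
module Submission where

open import Defs
open import Level using (Level)
open import Data.Nat using (ℕ; _≤_)
open import Data.Integer using (ℤ)
open import Algebra.Bundles using (CommutativeRing)

open import Data.Nat as ℕ using (zero; suc; s≤s; z≤n)
import Data.Nat.Properties as ℕP
open import Data.Integer as ℤ using (+_; -[1+_])
import Data.Integer.Properties as ℤP
open import Data.Bool using (Bool; true; false; _∧_; if_then_else_)
open import Data.Empty using (⊥-elim)
open import Data.Product using (_,_)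
open import Data.Maybe using (Maybe; just; nothing)
open import Data.Vec using (Vec; []; _∷_)
open import Data.List as L using (List)
import Data.List.Properties as LP
open import Function using (_∘_)
open import Relation.Nullary using (¬_; does; Dec; yes; no)
open import Relation.Binary.PropositionalEquality as Eq using (_≡_)
open import Algebra.Bundles using (Semiring)
import Algebra.Solver.CommutativeMonoid as CommutativeMonoidSolver
import Relation.Binary.Reasoning.Setoid as SetoidReasoning

does-exclusive : ∀ {A B : Set} → (A → ¬ B) → (a? : Dec A) (b? : Dec B) →
                 does a? ≡ true → does b? ≡ false
does-exclusive a⇒¬b (yes a) (yes b) _  = ⊥-elim (a⇒¬b a b)
does-exclusive a⇒¬b (yes a) (no _)  _  = Eq.refl
does-exclusive a⇒¬b (no _)  _       ()

IncreasingFrom : ∀ {k} → Maybe ℤ → Vec ℤ k → Set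
IncreasingFrom nothing  as = Increasing as
IncreasingFrom (just p) as = Increasing (p ∷ as)

IncreasingFrom-∷ : ∀ {k} p a (as : Vec ℤ k) → IncreasingFrom p (a ∷ as) → Increasing (a ∷ as)
IncreasingFrom-∷ nothing  a as inc       = inc
IncreasingFrom-∷ (just p) a as (_ , inc) = inc

Increasing-lastRow : ∀ {n} (t : Tri ℤ n) → IsMonotone t → Increasing (lastRow t)
Increasing-lastRow []      _             = _
Increasing-lastRow (t ▷ r) (_ , inc , _) = inc

northwest-excludes-northeast : ∀ {k} p a (as : Vec ℤ k) b → IncreasingFrom p (a ∷ as) →
                               eqMaybe p b ≡ true → does (a ℤ.≟ b) ≡ false
northwest-excludes-northeast nothing  a as b _ ()
northwest-excludes-northeast (just p) a as b (p<a , _) =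
  does-exclusive (λ p≡b a≡b → ℤP.<-irrefl (Eq.trans p≡b (Eq.sym a≡b)) p<a) (p ℤ.≟ b) (a ℤ.≟ b)

left-excludes-right : ∀ {a b b' : ℤ} → b ℤ.< b' → does (a ℤ.≟ b) ≡ true → does (a ℤ.≟ b') ≡ false
left-excludes-right {a} {b} {b'} b<b' =
  does-exclusive (λ a≡b a≡b' → ℤP.<-irrefl (Eq.trans (Eq.sym a≡b) a≡b') b<b') (a ℤ.≟ b) (a ℤ.≟ b')

module ListSums {c ℓ : Level} (S : Semiring c ℓ) where
  open Semiring S

  ∑ : ∀ {A : Set} → (A → Carrier) → List A → Carrier
  ∑ f xs = L.foldr _+_ 0# (L.map f xs)

  module _ {A : Set} where

    ∑-cong : ∀ {f g : A → Carrier} xs → (∀ x → f x ≈ g x) → ∑ f xs ≈ ∑ g xs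
    ∑-cong L.[]       f≈g = refl
    ∑-cong (x L.∷ xs) f≈g = +-cong (f≈g x) (∑-cong xs f≈g)

    ∑-++ : ∀ (f : A → Carrier) xs ys → ∑ f (xs L.++ ys) ≈ ∑ f xs + ∑ f ys
    ∑-++ f L.[]       ys = sym (+-identityˡ _)
    ∑-++ f (x L.∷ xs) ys = trans (+-congˡ (∑-++ f xs ys)) (sym (+-assoc _ _ _))

    ∑-*ˡ : ∀ a (f : A → Carrier) xs → ∑ (λ x → a * f x) xs ≈ a * ∑ f xs
    ∑-*ˡ a f L.[]       = sym (zeroʳ a)
    ∑-*ˡ a f (x L.∷ xs) = trans (+-congˡ (∑-*ˡ a f xs)) (sym (distribˡ a _ _))

  ∑-concatMap-* : ∀ {A B C : Set} (h : C → Carrier) (g : A → B → C)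
                  (F : A → Carrier) (G : B → Carrier) xs ys →
                  (∀ x y → h (g x y) ≈ F x * G y) →
                  ∑ h (L.concatMap (λ x → L.map (g x) ys) xs) ≈ ∑ F xs * ∑ G ys
  ∑-concatMap-* h g F G L.[]       ys h≈FG = sym (zeroˡ _)
  ∑-concatMap-* h g F G (x L.∷ xs) ys h≈FG = begin
    ∑ h (L.map (g x) ys L.++ rest)      ≈⟨ ∑-++ h (L.map (g x) ys) rest ⟩
    ∑ h (L.map (g x) ys) + ∑ h rest     ≡⟨ Eq.cong (λ zs → L.foldr _+_ 0# zs + ∑ h rest) (Eq.sym (LP.map-∘ ys)) ⟩
    ∑ (h ∘ g x) ys + ∑ h rest           ≈⟨ +-cong (∑-cong ys (h≈FG x)) (∑-concatMap-* h g F G xs ys h≈FG) ⟩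
    ∑ (λ y → F x * G y) ys + ∑ F xs * ∑ G ys ≈⟨ +-congʳ (∑-*ˡ (F x) G ys) ⟩
    F x * ∑ G ys + ∑ F xs * ∑ G ys      ≈⟨ sym (distribʳ _ _ _) ⟩
    ∑ F (x L.∷ xs) * ∑ G ys             ∎
    where
    open SetoidReasoning setoid
    rest = L.concatMap (λ x → L.map (g x) ys) xs

  if-∧-* : ∀ b b' p q → (if b ∧ b' then p * q else 0#) ≈ (if b then p else 0#) * (if b' then q else 0#)
  if-∧-* false b'    p q = sym (zeroˡ _)
  if-∧-* true  false p q = sym (zeroʳ p)
  if-∧-* true  true  p q = refl

  if-*ʳ : ∀ b p q → (if b then p * q else 0#) ≈ (if b then p else 0#) * q
  if-*ʳ true  p q = refl
  if-*ʳ false p q = sym (zeroˡ q)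

  if-*ˡ : ∀ b a {p q} → p ≈ a * q → (if b then p else 0#) ≈ a * (if b then q else 0#)
  if-*ˡ true  a p≈aq = p≈aq
  if-*ˡ false a p≈aq = sym (zeroʳ a)

module Proof {c ℓ : Level} (R : CommutativeRing c ℓ)
  (u v w : CommutativeRing.Carrier R) (X Xinv : ℕ → CommutativeRing.Carrier R) where
  open CommutativeRing R
  open Weights R u v w X Xinv
  open ListSums semiring
  open SetoidReasoning setoid
  open CommutativeMonoidSolver *-commutativeMonoid using (solve; _⊕_; _⊜_; id)

  pow-cong : ∀ {x y} n → x ≈ y → pow x n ≈ pow y n
  pow-cong zero    x≈y = refl
  pow-cong (suc n) x≈y = *-cong x≈y (pow-cong n x≈y)

  arrows : List Arrow
  arrows = NE L.∷ NW L.∷ NWNE L.∷ L.[]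

  rowWeight : ∀ {m} → ℕ → ℤ → Vec Arrow m → Carrier
  rowWeight i Δ d = pow u (count isNE d) * pow v (count isNW d) * pow w (count isNWNE d)
                    * zpow i (Δ ℤ.+ + count isNE d ℤ.- + count isNW d)

  lhs-▷ : ∀ {k} (t : Tri ℤ k) (b : Vec ℤ (suc k)) →
          lhs (t ▷ b) ≈ lhs t * ∑ (λ d → if validRow (lastRow t) b d
                                          then rowWeight (suc k) (rowSum b ℤ.- rowSum (lastRow t)) d
                                          else 0#) (allVec (suc k))
  lhs-▷ {k} t b = ∑-concatMap-* _ _▷_ _ _ (allDec k) (allVec (suc k))
    (λ dt d → if-∧-* (validDec t dt) (validRow (lastRow t) b d) _ _)

  module Row (i : ℕ) (x·x⁻¹≈1 : X i * Xinv i ≈ 1#) where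
    x x⁻¹ t : Carrier
    x   = X i
    x⁻¹ = Xinv i
    t   = u * x + v * x⁻¹ + w

    zpow-+1 : ∀ z → zpow i (z ℤ.+ + 1) ≈ zpow i z * x
    zpow-+1 (+ k)            = trans (reflexive (Eq.cong (zpow i ∘ +_) (ℕP.+-comm k 1))) (*-comm x _)
    zpow-+1 -[1+ zero ]      = sym (trans (*-congʳ (*-identityʳ x⁻¹)) (trans (*-comm x⁻¹ x) x·x⁻¹≈1))
    zpow-+1 -[1+ suc k ]     = sym (begin
      x⁻¹ * pow x⁻¹ (suc k) * x ≈⟨ solve 3 (λ y p z → (y ⊕ p) ⊕ z ⊜ p ⊕ (z ⊕ y)) refl x⁻¹ _ x ⟩
      pow x⁻¹ (suc k) * (x * x⁻¹) ≈⟨ *-congˡ x·x⁻¹≈1 ⟩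
      pow x⁻¹ (suc k) * 1#        ≈⟨ *-identityʳ _ ⟩
      pow x⁻¹ (suc k)             ∎)

    zpow--1 : ∀ z → zpow i (z ℤ.- + 1) ≈ zpow i z * x⁻¹
    zpow--1 (+ zero)  = *-comm x⁻¹ 1#
    zpow--1 (+ suc k) = sym (begin
      x * pow x k * x⁻¹ ≈⟨ solve 3 (λ y p z → (y ⊕ p) ⊕ z ⊜ p ⊕ (y ⊕ z)) refl x _ x⁻¹ ⟩
      pow x k * (x * x⁻¹) ≈⟨ *-congˡ x·x⁻¹≈1 ⟩
      pow x k * 1#        ≈⟨ *-identityʳ _ ⟩
      pow x k             ∎)
    zpow--1 -[1+ k ]  = trans (reflexive (Eq.cong (λ m → zpow i -[1+ suc m ]) (ℕP.+-identityʳ k)))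
                              (*-comm x⁻¹ _)

    zpow-+ : ∀ z a → zpow i (z ℤ.+ + a) ≈ zpow i z * pow x a
    zpow-+ z zero    = trans (reflexive (Eq.cong (zpow i) (ℤP.+-identityʳ z))) (sym (*-identityʳ _))
    zpow-+ z (suc a) = begin
      zpow i (z ℤ.+ + suc a)         ≡⟨ Eq.cong (zpow i) (Eq.sym (ℤP.+-assoc z (+ 1) (+ a))) ⟩
      zpow i ((z ℤ.+ + 1) ℤ.+ + a)   ≈⟨ zpow-+ (z ℤ.+ + 1) a ⟩
      zpow i (z ℤ.+ + 1) * pow x a   ≈⟨ *-congʳ (zpow-+1 z) ⟩
      zpow i z * x * pow x a         ≈⟨ *-assoc _ _ _ ⟩
      zpow i z * pow x (suc a)       ∎

    zpow-- : ∀ z b → zpow i (z ℤ.- + b) ≈ zpow i z * pow x⁻¹ b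
    zpow-- z zero    = trans (reflexive (Eq.cong (zpow i) (ℤP.+-identityʳ z))) (sym (*-identityʳ _))
    zpow-- z (suc b) = begin
      zpow i (z ℤ.- + suc b)           ≡⟨ Eq.cong (zpow i) split ⟩
      zpow i ((z ℤ.- + 1) ℤ.- + b)     ≈⟨ zpow-- (z ℤ.- + 1) b ⟩
      zpow i (z ℤ.- + 1) * pow x⁻¹ b   ≈⟨ *-congʳ (zpow--1 z) ⟩
      zpow i z * x⁻¹ * pow x⁻¹ b       ≈⟨ *-assoc _ _ _ ⟩
      zpow i z * pow x⁻¹ (suc b)       ∎
      where
      split : z ℤ.- + suc b ≡ (z ℤ.- + 1) ℤ.- + b
      split = Eq.trans (Eq.cong (λ m → z ℤ.+ m) (ℤP.neg-distrib-+ (+ 1) (+ b)))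
                       (Eq.sym (ℤP.+-assoc z (ℤ.- + 1) (ℤ.- + b)))

    zpow-+- : ∀ z a b → zpow i (z ℤ.+ + a ℤ.- + b) ≈ zpow i z * pow x a * pow x⁻¹ b
    zpow-+- z a b = trans (zpow-- (z ℤ.+ + a) b) (*-congʳ (zpow-+ z a))

    arrowWeight : Arrow → Carrier
    arrowWeight NE   = u * x
    arrowWeight NW   = v * x⁻¹
    arrowWeight NWNE = w

    decorationWeight : ∀ {m} → Vec Arrow m → Carrier
    decorationWeight []       = 1#
    decorationWeight (d ∷ ds) = arrowWeight d * decorationWeight ds

    arrowMonomial : ℕ → ℕ → ℕ → Carrier
    arrowMonomial ne nw nwne = pow u ne * pow v nw * pow w nwne * (pow x ne * pow x⁻¹ nw)

    decorationWeight≈arrowMonomial : ∀ {m} (d : Vec Arrow m) →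
      decorationWeight d ≈ arrowMonomial (count isNE d) (count isNW d) (count isNWNE d)
    decorationWeight≈arrowMonomial [] =
      sym (solve 0 ((((id ⊕ id) ⊕ id) ⊕ (id ⊕ id)) ⊜ id) refl)
    decorationWeight≈arrowMonomial (NE ∷ ds) = trans (*-congˡ (decorationWeight≈arrowMonomial ds))
      (solve 7 (λ a x pu pv pw px py → (a ⊕ x) ⊕ (((pu ⊕ pv) ⊕ pw) ⊕ (px ⊕ py))
                                     ⊜ (((a ⊕ pu) ⊕ pv) ⊕ pw) ⊕ ((x ⊕ px) ⊕ py)) refl u x _ _ _ _ _)
    decorationWeight≈arrowMonomial (NW ∷ ds) = trans (*-congˡ (decorationWeight≈arrowMonomial ds))
      (solve 7 (λ b y pu pv pw px py → (b ⊕ y) ⊕ (((pu ⊕ pv) ⊕ pw) ⊕ (px ⊕ py))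
                                     ⊜ ((pu ⊕ (b ⊕ pv)) ⊕ pw) ⊕ (px ⊕ (y ⊕ py))) refl v x⁻¹ _ _ _ _ _)
    decorationWeight≈arrowMonomial (NWNE ∷ ds) = trans (*-congˡ (decorationWeight≈arrowMonomial ds))
      (solve 6 (λ c pu pv pw px py → c ⊕ (((pu ⊕ pv) ⊕ pw) ⊕ (px ⊕ py))
                                   ⊜ ((pu ⊕ pv) ⊕ (c ⊕ pw)) ⊕ (px ⊕ py)) refl w _ _ _ _ _)

    rowWeight≈ : ∀ {m} Δ (d : Vec Arrow m) → rowWeight i Δ d ≈ zpow i Δ * decorationWeight d
    rowWeight≈ Δ d = begin
      pu * pv * pw * zpow i (Δ ℤ.+ + count isNE d ℤ.- + count isNW d)
        ≈⟨ *-congˡ (zpow-+- Δ (count isNE d) (count isNW d)) ⟩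
      pu * pv * pw * (zpow i Δ * px * py)
        ≈⟨ solve 6 (λ pu pv pw z px py → ((pu ⊕ pv) ⊕ pw) ⊕ ((z ⊕ px) ⊕ py)
                                        ⊜ z ⊕ (((pu ⊕ pv) ⊕ pw) ⊕ (px ⊕ py))) refl pu pv pw _ px py ⟩
      zpow i Δ * arrowMonomial (count isNE d) (count isNW d) (count isNWNE d)
        ≈⟨ *-congˡ (sym (decorationWeight≈arrowMonomial d)) ⟩
      zpow i Δ * decorationWeight d ∎
      where
      pu = pow u (count isNE d)
      pv = pow v (count isNW d)
      pw = pow w (count isNWNE d)
      px = pow x (count isNE d)
      py = pow x⁻¹ (count isNW d)

    -- Total weight of the arrows allowed on an entry that equals its
    -- northwest / northeast neighbour; both at once never happens.
    entryWeight : Bool → Bool → Carrier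
    entryWeight true  true  = 0#
    entryWeight true  false = u * x
    entryWeight false true  = v * x⁻¹
    entryWeight false false = t

    ∑-allowedArrows : ∀ nw ne →
      ∑ (λ d → if implies nw (isNEᵇ d) ∧ implies ne (isNWᵇ d) then arrowWeight d else 0#) arrows
      ≈ entryWeight nw ne
    ∑-allowedArrows true  true  = trans (+-identityˡ _) (trans (+-identityˡ _) (+-identityˡ _))
    ∑-allowedArrows true  false = trans (+-congˡ (trans (+-identityˡ _) (+-identityˡ _))) (+-identityʳ _)
    ∑-allowedArrows false true  = trans (+-identityˡ _) (trans (+-congˡ (+-identityˡ _)) (+-identityʳ _))
    ∑-allowedArrows false false = trans (+-congˡ (+-congˡ (+-identityʳ w))) (sym (+-assoc _ _ _))

    validSummand : ∀ {k} → Maybe ℤ → Vec ℤ k → Vec ℤ (suc k) → Vec Arrow (suc k) → Carrier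
    validSummand p as bs d = if validRow' p as bs d then decorationWeight d else 0#

    validDecorationSum : ∀ {k} → Maybe ℤ → Vec ℤ k → Vec ℤ (suc k) → Carrier
    validDecorationSum {k} p as bs = ∑ (validSummand p as bs) (allVec (suc k))

    validDecorationSum-[] : ∀ p b → validDecorationSum p [] (b ∷ []) ≈ entryWeight (eqMaybe p b) false
    validDecorationSum-[] p b = begin
      validDecorationSum p [] (b ∷ [])
        ≈⟨ ∑-concatMap-* (validSummand p [] (b ∷ [])) _∷_ entry (λ _ → 1#) arrows (allVec 0)
             (λ { d [] → if-*ʳ (cond p nothing b d) (arrowWeight d) 1# }) ⟩
      ∑ entry arrows * (1# + 0#)       ≈⟨ *-cong (∑-allowedArrows (eqMaybe p b) false) (+-identityʳ 1#) ⟩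
      entryWeight (eqMaybe p b) false * 1# ≈⟨ *-identityʳ _ ⟩
      entryWeight (eqMaybe p b) false ∎
      where
      entry : Arrow → Carrier
      entry d = if cond p nothing b d then arrowWeight d else 0#

    validDecorationSum-∷ : ∀ {k} p a (as : Vec ℤ k) b b' bs →
      validDecorationSum p (a ∷ as) (b ∷ b' ∷ bs)
      ≈ entryWeight (eqMaybe p b) (does (a ℤ.≟ b)) * validDecorationSum (just a) as (b' ∷ bs)
    validDecorationSum-∷ {k} p a as b b' bs =
      trans (∑-concatMap-* (validSummand p (a ∷ as) (b ∷ b' ∷ bs)) _∷_ entry (validSummand (just a) as (b' ∷ bs)) arrows (allVec (suc k)) factor)
            (*-congʳ (∑-allowedArrows (eqMaybe p b) (does (a ℤ.≟ b))))
      where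
      entry : Arrow → Carrier
      entry d = if cond p (just a) b d then arrowWeight d else 0#
      factor : ∀ d ds → validSummand p (a ∷ as) (b ∷ b' ∷ bs) (d ∷ ds)
                        ≈ entry d * validSummand (just a) as (b' ∷ bs) ds
      factor d (d' ∷ ds) = if-∧-* (cond p (just a) b d) (validRow' (just a) as (b' ∷ bs) (d' ∷ ds)) _ _

    -- entryWeight reused with the flags "a_j is right-leaning", "a_j is left-leaning".
    leaningProduct : ∀ {k} → Vec ℤ k → Vec ℤ (suc k) → Carrier
    leaningProduct []       (b ∷ [])      = t
    leaningProduct (a ∷ as) (b ∷ b' ∷ bs) =
      entryWeight (does (a ℤ.≟ b')) (does (a ℤ.≟ b)) * leaningProduct as (b' ∷ bs)

    -- Relates the entrywise product over the lower row b (factor j reads a_{j-1}, a_j)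
    -- to the leaning product over the upper row a (factor j reads b_j, b_{j+1}):
    -- they agree, except that when b_0 equals its northwest neighbour it
    -- contributes uX where the leaning product has its extra t.
    Shifted : Bool → Carrier → Carrier → Set ℓ
    Shifted true  G F = G * t ≈ (u * x) * F
    Shifted false G F = G ≈ F

    Shifted-congˡ : ∀ nw {G G' F} → G ≈ G' → Shifted nw G' F → Shifted nw G F
    Shifted-congˡ true  G≈G' sh = trans (*-congʳ G≈G') sh
    Shifted-congˡ false G≈G' sh = trans G≈G' sh

    Shifted-[] : ∀ nw {G} → G ≈ entryWeight nw false → Shifted nw G t
    Shifted-[] true  G≈ = *-congʳ G≈
    Shifted-[] false G≈ = G≈

    Shifted-∷ : ∀ nw left right {G F} → (nw ≡ true → left ≡ false) → (left ≡ true → right ≡ false) →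
                Shifted right G F → Shifted nw (entryWeight nw left * G) (entryWeight right left * F)
    Shifted-∷ true  true  _     excl₁ _     _  with excl₁ Eq.refl
    ... | ()
    Shifted-∷ true  false true  _     _     sh = trans (*-assoc _ _ _) (*-congˡ sh)
    Shifted-∷ true  false false _     _     sh = trans (*-assoc _ _ _) (*-congˡ (trans (*-comm _ t) (*-congˡ sh)))
    Shifted-∷ false true  true  _     excl₂ _  with excl₂ Eq.refl
    ... | ()
    Shifted-∷ false true  false _     _     sh = *-congˡ sh
    Shifted-∷ false false true  _     _     sh = trans (*-comm t _) sh
    Shifted-∷ false false false _     _     sh = *-congˡ sh

    validDecorationSum≈leaningProduct : ∀ {k} p (as : Vec ℤ k) b bs →
      IncreasingFrom p as → Increasing (b ∷ bs) →
      Shifted (eqMaybe p b) (validDecorationSum p as (b ∷ bs)) (leaningProduct as (b ∷ bs))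
    validDecorationSum≈leaningProduct p [] b [] _ _ =
      Shifted-[] (eqMaybe p b) (validDecorationSum-[] p b)
    validDecorationSum≈leaningProduct p (a ∷ as) b (b' ∷ bs) incA (b<b' , incB) =
      Shifted-congˡ (eqMaybe p b) (validDecorationSum-∷ p a as b b' bs)
        (Shifted-∷ (eqMaybe p b) (does (a ℤ.≟ b)) (does (a ℤ.≟ b'))
           (northwest-excludes-northeast p a as b incA) (left-excludes-right {a} b<b')
           (validDecorationSum≈leaningProduct (just a) as b' bs (IncreasingFrom-∷ p a as incA) incB))

    leaningMonomial : ℕ → ℕ → ℕ → Carrier
    leaningMonomial r l s = pow u r * pow v l * (pow x r * pow x⁻¹ l) * pow t s

    *-leaningMonomial-right : ∀ r l s → (u * x) * leaningMonomial r l s ≈ leaningMonomial (suc r) l s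
    *-leaningMonomial-right r l s =
      solve 7 (λ a y pu pv px py pt → (a ⊕ y) ⊕ (((pu ⊕ pv) ⊕ (px ⊕ py)) ⊕ pt)
                                    ⊜ (((a ⊕ pu) ⊕ pv) ⊕ ((y ⊕ px) ⊕ py)) ⊕ pt) refl u x _ _ _ _ _

    *-leaningMonomial-left : ∀ r l s → (v * x⁻¹) * leaningMonomial r l s ≈ leaningMonomial r (suc l) s
    *-leaningMonomial-left r l s =
      solve 7 (λ b y pu pv px py pt → (b ⊕ y) ⊕ (((pu ⊕ pv) ⊕ (px ⊕ py)) ⊕ pt)
                                    ⊜ ((pu ⊕ (b ⊕ pv)) ⊕ (px ⊕ (y ⊕ py))) ⊕ pt) refl v x⁻¹ _ _ _ _ _

    *-leaningMonomial-special : ∀ r l s → t * leaningMonomial r l s ≈ leaningMonomial r l (suc s)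
    *-leaningMonomial-special r l s =
      solve 6 (λ c pu pv px py pt → c ⊕ (((pu ⊕ pv) ⊕ (px ⊕ py)) ⊕ pt)
                                  ⊜ ((pu ⊕ pv) ⊕ (px ⊕ py)) ⊕ (c ⊕ pt)) refl t _ _ _ _ _

    absorb : ∀ {c m m'} → c * m ≈ m' → c * (m * t) ≈ m' * t
    absorb cm≈m' = trans (sym (*-assoc _ _ _)) (*-congʳ cm≈m')

    leaningStep : ∀ {a b b' : ℤ} r l s → b ℤ.≤ a → a ℤ.≤ b' → b ℤ.< b' →
      (right? : Dec (a ≡ b')) (left? : Dec (a ≡ b)) (above? : Dec (b ℤ.< a)) (below? : Dec (a ℤ.< b')) →
      entryWeight (does right?) (does left?) * (leaningMonomial r l s * t)
      ≈ leaningMonomial ((if does right? then 1 else 0) ℕ.+ r) ((if does left? then 1 else 0) ℕ.+ l)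
                        ((if does above? ∧ does below? then 1 else 0) ℕ.+ s) * t
    leaningStep r l s b≤a a≤b' b<b' (yes a≡b') (yes a≡b) _ _ =
      ⊥-elim (ℤP.<-irrefl (Eq.trans (Eq.sym a≡b) a≡b') b<b')
    leaningStep r l s b≤a a≤b' b<b' (yes a≡b') (no _) _ (yes a<b') = ⊥-elim (ℤP.<-irrefl a≡b' a<b')
    leaningStep r l s b≤a a≤b' b<b' (yes _) (no _) (yes _) (no _) = absorb (*-leaningMonomial-right r l s)
    leaningStep r l s b≤a a≤b' b<b' (yes _) (no _) (no _)  (no _) = absorb (*-leaningMonomial-right r l s)
    leaningStep r l s b≤a a≤b' b<b' (no _) (yes a≡b) (yes b<a) _ = ⊥-elim (ℤP.<-irrefl (Eq.sym a≡b) b<a)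
    leaningStep r l s b≤a a≤b' b<b' (no _) (yes _) (no _) _ = absorb (*-leaningMonomial-left r l s)
    leaningStep r l s b≤a a≤b' b<b' (no _) (no _) (yes _) (yes _) = absorb (*-leaningMonomial-special r l s)
    leaningStep r l s b≤a a≤b' b<b' (no _) (no a≢b) (no b≮a) _ =
      ⊥-elim (b≮a (ℤP.≤∧≢⇒< b≤a (a≢b ∘ Eq.sym)))
    leaningStep r l s b≤a a≤b' b<b' (no a≢b') (no _) (yes _) (no a≮b') =
      ⊥-elim (a≮b' (ℤP.≤∧≢⇒< a≤b' a≢b'))

    leaningProduct≈leaningMonomial : ∀ {k} (a : Vec ℤ k) b → Interlace a b → Increasing b →
      leaningProduct a b ≈ leaningMonomial (rCount a b) (lCount a b) (sCount a b) * t
    leaningProduct≈leaningMonomial [] (b ∷ []) _ _ =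
      sym (trans (*-congʳ (solve 0 ((((id ⊕ id) ⊕ (id ⊕ id)) ⊕ id) ⊜ id) refl)) (*-identityˡ t))
    leaningProduct≈leaningMonomial (a ∷ as) (b ∷ b' ∷ bs) (b≤a , a≤b' , interlace) (b<b' , inc) =
      trans (*-congˡ (leaningProduct≈leaningMonomial as (b' ∷ bs) interlace inc))
            (leaningStep (rCount as (b' ∷ bs)) (lCount as (b' ∷ bs)) (sCount as (b' ∷ bs)) b≤a a≤b' b<b'
                         (a ℤ.≟ b') (a ℤ.≟ b) (b ℤ.<? a) (a ℤ.<? b'))

    ∑-rowWeight : ∀ {k} Δ (a : Vec ℤ k) b → Increasing a → Increasing b → Interlace a b →
      ∑ (λ d → if validRow a b d then rowWeight i Δ d else 0#) (allVec (suc k))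
      ≈ zpow i Δ * (leaningMonomial (rCount a b) (lCount a b) (sCount a b) * t)
    ∑-rowWeight {k} Δ a (b ∷ bs) incA incB interlace = begin
      ∑ (λ d → if validRow a (b ∷ bs) d then rowWeight i Δ d else 0#) (allVec (suc k))
        ≈⟨ ∑-cong (allVec (suc k)) (λ d → if-*ˡ (validRow a (b ∷ bs) d) (zpow i Δ) (rowWeight≈ Δ d)) ⟩
      ∑ (λ d → zpow i Δ * (if validRow a (b ∷ bs) d then decorationWeight d else 0#)) (allVec (suc k))
        ≈⟨ ∑-*ˡ (zpow i Δ) _ (allVec (suc k)) ⟩
      zpow i Δ * validDecorationSum nothing a (b ∷ bs)
        ≈⟨ *-congˡ (validDecorationSum≈leaningProduct nothing a b bs incA incB) ⟩
      zpow i Δ * leaningProduct a (b ∷ bs)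
        ≈⟨ *-congˡ (leaningProduct≈leaningMonomial a (b ∷ bs) interlace incB) ⟩
      zpow i Δ * (leaningMonomial (rCount a (b ∷ bs)) (lCount a (b ∷ bs)) (sCount a (b ∷ bs)) * t) ∎

  lhs≈rhs : ∀ n → (∀ i → 1 ≤ i → i ≤ n → X i * Xinv i ≈ 1#) →
            (M : Tri ℤ n) → IsMonotone M → lhs M ≈ rhs M
  lhs≈rhs zero    _   []      _ = trans (+-identityʳ 1#) (sym (*-identityʳ 1#))
  lhs≈rhs (suc k) inv (M ▷ b) (monoM , incB , interlace) = begin
    lhs (M ▷ b)
      ≈⟨ lhs-▷ M b ⟩
    lhs M * ∑ (λ d → if validRow a b d then rowWeight (suc k) Δ d else 0#) (allVec (suc k))
      ≈⟨ *-cong (lhs≈rhs k inv-k M monoM) (∑-rowWeight Δ a b (Increasing-lastRow M monoM) incB interlace) ⟩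
    W₀ M * prodFactor k * (zpow (suc k) Δ * (leaningMonomial r l s * t))
      ≈⟨ solve 9 (λ W′ P z pu pv px py pt t → (W′ ⊕ P) ⊕ (z ⊕ ((((pu ⊕ pv) ⊕ (px ⊕ py)) ⊕ pt) ⊕ t))
                                           ⊜ (W′ ⊕ (((pu ⊕ pv) ⊕ ((z ⊕ px) ⊕ py)) ⊕ pt)) ⊕ (P ⊕ t))
                 refl (W₀ M) (prodFactor k) (zpow (suc k) Δ) _ _ _ _ _ t ⟩
    W₀ M * (pow u r * pow v l * (zpow (suc k) Δ * pow x r * pow x⁻¹ l) * pow t s) * (prodFactor k * t)
      ≈⟨ *-congʳ (*-congˡ (*-cong (*-congˡ (sym (zpow-+- Δ r l))) (pow-cong s t≈w+ux+vx⁻¹))) ⟩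
    rhs (M ▷ b) ∎
    where
    inv-k : ∀ i → 1 ≤ i → i ≤ k → X i * Xinv i ≈ 1#
    inv-k i 1≤i i≤k = inv i 1≤i (ℕP.m≤n⇒m≤1+n i≤k)
    open Row (suc k) (inv (suc k) (s≤s z≤n) ℕP.≤-refl)
    a = lastRow M
    Δ = rowSum b ℤ.- rowSum a
    r = rCount a b
    l = lCount a b
    s = sCount a b
    t≈w+ux+vx⁻¹ : t ≈ w + u * x + v * x⁻¹
    t≈w+ux+vx⁻¹ = trans (+-comm (u * x + v * x⁻¹) w) (sym (+-assoc w _ _))

proposition3p3 : ∀ {c ℓ : Level} (R : CommutativeRing c ℓ) (n : ℕ)
    (u v w : CommutativeRing.Carrier R)
    (X Xinv : ℕ → CommutativeRing.Carrier R) →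
    (∀ i → 1 ≤ i → i ≤ n →
      CommutativeRing._≈_ R (CommutativeRing._*_ R (X i) (Xinv i)) (CommutativeRing.1# R)) →
    (M : Tri ℤ n) → IsMonotone M →
    CommutativeRing._≈_ R (Weights.lhs R u v w X Xinv M) (Weights.rhs R u v w X Xinv M)
proposition3p3 R n u v w X Xinv = Proof.lhs≈rhs R u v w X Xinv n
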